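{- Let $T[\cdot]$ be a context and $A,B$ formulae. If the sequent $A \mid\ \vdash B$ (stoup $A$, empty context) is derivable in $\mathtt{LSkG}$, then the sequent $T[A]^* \mid\ \vdash T[B]^*$ is derivable in $\mathtt{LSkG}$.
   Context: Formulae are generated by $A,B ::= X \mid \mathsf{I} \mid A \otimes B \mid A \multimap B$, with $X$ ranging over a set of atoms. A sequent of $\mathtt{LSkG}$ has the form $S \mid \Gamma \vdash A$, where the stoup $S$ is either a single formula or empty ($S={ - }$), $\Gamma$ is a finite ordered list of formulae, and $A$ is a formula. Derivations of $\mathtt{LSkG}$ are generated by the rules: (ax) $A \mid\ \vdash A$; ($\multimap$L) from ${ - } \mid \Gamma \vdash A$ and $B \mid \Delta \vdash C$ infer $A \multimap B \mid \Gamma,\Delta \vdash C$; (IL) from ${ - } \mid \Gamma \vdash C$ infer $\mathsf{I} \mid \Gamma \vdash C$; ($\otimes$L) from $A \mid B,\Gamma \vdash C$ infer $A\otimes B \mid \Gamma \vdash C$; (pass) from $A \mid \Gamma \vdash C$ infer ${ - } \mid A,\Gamma \vdash C$; ($\multimap$R) from $S \mid \Gamma, A \vdash B$ infer $S \mid \Gamma \vdash A \multimap B$; (IR) ${ - } \mid\ \vdash \mathsf{I}$; ($\otimes$R) from $S \mid \Gamma \vdash A$ and ${ - } \mid \Delta \vdash B$ infer $S \mid \Gamma,\Delta \vdash A \otimes B$. Trees are generated by $T ::= A \mid { - } \mid (T,T)$ ($A$ a formula, ${ - }$ the empty tree); contexts by $\mathcal{C} ::= [\cdot] \mid (\mathcal{C},T)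 \mid (T,\mathcal{C})$; $T[U]$ is the result of substituting the tree $U$ for the hole of $T[\cdot]$. For a tree $T$, $T^*$ is the formula obtained by replacing every comma (pairing) by $\otimes$ and every empty tree ${ - }$ by $\mathsf{I}$, i.e. $A^*=A$, ${ - }^*=\mathsf{I}$, $(T_1,T_2)^* = T_1^* \otimes T_2^*$. -}

module Defs where

open import Data.List using (List; []; _∷_; _++_)
open import Data.Maybe using (Maybe; just; nothing)

module LSkG (At : Set) where

  infixr 25 _⊸_
  infixl 30 _⊗_
  data Fma : Set where
    ` : At → Fma
    I : Fma
    _⊗_ : Fma → Fma → Fma
    _⊸_ : Fma → Fma → Fma

  Stp : Set
  Stp = Maybe Fma

  Cxt : Set
  Cxt = List Fma

  infix 15 _∣_⊢_
  data _∣_⊢_ : Stp → Cxt → Fma → Set where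
    ax : ∀ {A} → just A ∣ [] ⊢ A
    ⊸L : ∀ {Γ Δ A B C} → nothing ∣ Γ ⊢ A → just B ∣ Δ ⊢ C → just (A ⊸ B) ∣ Γ ++ Δ ⊢ C
    IL : ∀ {Γ C} → nothing ∣ Γ ⊢ C → just I ∣ Γ ⊢ C
    ⊗L : ∀ {Γ A B C} → just A ∣ B ∷ Γ ⊢ C → just (A ⊗ B) ∣ Γ ⊢ C
    pass : ∀ {Γ A C} → just A ∣ Γ ⊢ C → nothing ∣ A ∷ Γ ⊢ C
    ⊸R : ∀ {S Γ A B} → S ∣ Γ ++ (A ∷ []) ⊢ B → S ∣ Γ ⊢ A ⊸ B
    IR : nothing ∣ [] ⊢ I
    ⊗R : ∀ {S Γ Δ A B} → S ∣ Γ ⊢ A → nothing ∣ Δ ⊢ B → S ∣ Γ ++ Δ ⊢ A ⊗ B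

  -- Trees: T ::= A | - | (T , T)
  data Tree : Set where
    leaf : Fma → Tree
    η : Tree
    _,,_ : Tree → Tree → Tree

  data TCtx : Set where
    hole : TCtx
    _◂_ : TCtx → Tree → TCtx
    _▸_ : Tree → TCtx → TCtx

  _[_] : TCtx → Tree → Tree
  hole [ U ] = U
  (C ◂ T) [ U ] = (C [ U ]) ,, T
  (T ▸ C) [ U ] = T ,, (C [ U ])

  _* : Tree → Fma
  leaf A * = A
  η * = I
  (T₁ ,, T₂) * = (T₁ *) ⊗ (T₂ *)

{-# OPTIONS --safe #-}
module Submission where

open import Defs
open import Data.List using ([])
open import Data.Maybe using (just)

module _ (At : Set) where
  open LSkG At

  ⊗-map : ∀ {A A′ B B′} → just A ∣ [] ⊢ A′ → just B ∣ [] ⊢ B′ → just (A ⊗ B) ∣ [] ⊢ A′ ⊗ B′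
  ⊗-map f g = ⊗L (⊗R f (pass g))

  plug*-map : (T : TCtx) {A B : Fma} → just A ∣ [] ⊢ B → just ((T [ leaf A ]) *) ∣ [] ⊢ (T [ leaf B ]) *
  plug*-map hole    f = f
  plug*-map (C ◂ U) f = ⊗-map (plug*-map C f) ax
  plug*-map (U ▸ C) f = ⊗-map ax (plug*-map C f)

mainTheorem3 : (At : Set) → (T : LSkG.TCtx At) → (A B : LSkG.Fma At) → LSkG._∣_⊢_ At (just A) [] B → LSkG._∣_⊢_ At (just (LSkG._* At (LSkG._[_] At T (LSkG.leaf A)))) [] (LSkG._* At (LSkG._[_] At T (LSkG.leaf B)))
mainTheorem3 At T A B = plug*-map At T
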